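{- For all integers $n\geq 3$ and $t\geq 1$, the directed $(n,t)$-tadpole admits a strong SAAL.
   Context: The directed $(n,t)$-tadpole has vertices $v_1,\ldots,v_n,u_1,\ldots,u_t$ and arcs $v_iv_{i+1}$ ($1\le i\le n-1$), $v_nv_1$, $u_iu_{i+1}$ ($1\le i\le t-1$), and $u_tv_1$ (a directed cycle $C_n$ joined by an arc to a directed path on $t$ vertices). For a digraph $G=(V,A)$, a total labeling is a bijection $\lambda:V\cup A\to\{1,2,\ldots,|V|+|A|\}$. For an arc $xy$ (tail $x$, head $y$), $wt^-(xy)=\lambda(xy)+\lambda(y)-\lambda(x)$. An SAAL is a total labeling whose arc-weights $wt^-(xy)$ are pairwise distinct. A total labeling is strong if $\lambda(V)=\{1,\ldots,|V|\}$. -}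

module Defs where

open import Data.Nat using (ℕ; zero; suc; _+_; _≤_; _<_)
open import Data.Nat.Properties using (_<?_; _≟_)
open import Data.Fin using (Fin; toℕ; fromℕ<)
open import Data.Sum using (_⊎_; inj₁; inj₂)
open import Data.Product using (Σ; _×_; _,_; ∃)
open import Data.Integer using (ℤ; +_; _-_)
import Data.Integer as ℤ
import Data.Nat
import Data.Nat.Properties
import Data.Fin.Properties
open import Function.Definitions using (Injective)
open import Relation.Binary.PropositionalEquality using (_≡_)
open import Relation.Nullary using (yes; no)
open import Function.Bundles using (_⤖_)

record Digraph : Set where
  field
    V    : ℕ
    A    : ℕ
    tail : Fin A → Fin V
    head : Fin A → Fin V
open Digraph public

Elem : Digraph → Set
Elem G = Fin (V G) ⊎ Fin (A G)

Range : ℕ → Set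
Range m = Σ ℕ λ k → (1 ≤ k) × (k ≤ m)

TotalLabeling : Digraph → Set
TotalLabeling G = Elem G ⤖ Range (V G + A G)

lab : (G : Digraph) → TotalLabeling G → Elem G → ℕ
lab G λ' x = Data.Product.proj₁ (Function.Bundles.Bijection.to λ' x)
  where import Function.Bundles

wt⁻ : (G : Digraph) → TotalLabeling G → Fin (A G) → ℤ
wt⁻ G λ' a = (+ lab G λ' (inj₂ a) ℤ.+ + lab G λ' (inj₁ (head G a))) - + lab G λ' (inj₁ (tail G a))

IsSAAL : (G : Digraph) → TotalLabeling G → Set
IsSAAL G λ' = Injective _≡_ _≡_ (wt⁻ G λ')

-- strong: λ(V) = {1,…,|V|}
IsStrong : (G : Digraph) → TotalLabeling G → Set
IsStrong G λ' = ∀ (v : Fin (V G)) → lab G λ' (inj₁ v) ≤ V G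

-- Vertex index i < n is v_{i+1}; index n + j is u_{j+1}.
-- Arc index k < n-1 : v_{k+1} → v_{k+2};  k = n-1 : v_n → v_1;
-- k = n + j, j < t-1 : u_{j+1} → u_{j+2};  k = n + t - 1 : u_t → v_1.
-- (Meaningful for n ≥ 1; used for n ≥ 3, t ≥ 1.)
tadHead : (n t : ℕ) → Fin (n + t) → Fin (n + t)
tadHead n t k with suc (toℕ k) <? n + t
... | no _ = fromℕ< {0} (Data.Nat.Properties.≤-<-trans Data.Nat.z≤n (Data.Fin.Properties.toℕ<n k))
                                                   -- k = n+t-1 : u_t → v_1
... | yes p with suc (toℕ k) ≟ n
...   | yes _ = fromℕ< {0} (Data.Nat.Properties.≤-<-trans Data.Nat.z≤n (Data.Fin.Properties.toℕ<n k))
                                                   -- k = n-1 : v_n → v_1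
...   | no _ = fromℕ< p                            -- v_{k+1}→v_{k+2} or u_{j+1}→u_{j+2}

tadpole : (n t : ℕ) → Digraph
tadpole n t = record { V = n + t ; A = n + t ; tail = λ k → k ; head = tadHead n t }

{-# OPTIONS --safe #-}
-- Write N = n + t. Label the vertices 1, …, N in index order and give the arc with tail of
-- index a the label N + 1 + π a, where π swaps the indices of v_{n-1}v_n and v_nv_1. A forward
-- arc then has weight N + 2 + π a, while v_nv_1 has weight N and u_tv_1 has weight N + 1; the
-- swap is what keeps the last two apart, which would otherwise both have weight N + 1.
module Submission where

open import Defs
open import Data.Nat using (ℕ; zero; suc; _+_; _≤_; _<_; z≤n; s≤s)
import Data.Nat.Properties as ℕ
open import Data.Nat.Properties using (suc-injective; ≤-irrelevant; ≤-antisym; ≮⇒≥; m≤m+n; m+n∸m≡n; +-cancelˡ-≡; <⇒≢)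
open import Data.Nat.Tactic.RingSolver using (solve-∀)
open import Data.Fin using (Fin; toℕ; fromℕ<)
import Data.Fin as Fin
open import Data.Fin.Properties using (toℕ-injective; toℕ<n; toℕ-fromℕ<; fromℕ<-toℕ; +↔⊎; toℕ-↑ˡ; toℕ-↑ʳ)
open import Data.Fin.Permutation using (Permutation′; _⟨$⟩ʳ_; transpose)
import Data.Fin.Permutation.Components as PC
open import Data.Integer using (+_; _-_; _⊖_)
open import Data.Integer.Properties using (pos-+; [+m]-[+n]≡m⊖n; ⊖-≥; +-injective)
open import Data.Product using (Σ; _×_; _,_; proj₁)
open import Data.Sum using (inj₁; inj₂)
open import Data.Sum.Function.Propositional using (_⊎-↔_)
open import Function.Bundles using (_↔_; mk↔ₛ′; Injection)
open import Function.Construct.Composition using (_↔-∘_)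
open import Function.Construct.Identity using (↔-id)
open import Function.Construct.Symmetry using (↔-sym)
open import Function.Properties.Inverse using (↔⇒⤖; ↔⇒↣)
open import Relation.Binary.PropositionalEquality using (_≡_; _≢_; refl; sym; trans; cong; cong₂; subst; module ≡-Reasoning)
open import Relation.Nullary using (yes; no)
open import Relation.Nullary.Decidable using (dec-true; dec-false)

open ≡-Reasoning

private variable m : ℕ

Range-≡ : {x y : Range m} → proj₁ x ≡ proj₁ y → x ≡ y
Range-≡ {x = k , 1≤k , k≤m} {.k , 1≤k′ , k≤m′} refl
  rewrite ≤-irrelevant 1≤k 1≤k′ | ≤-irrelevant k≤m k≤m′ = refl

Fin↔Range : Fin m ↔ Range m
Fin↔Range = mk↔ₛ′ to from to∘from from∘to
  where
  to : Fin m → Range m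
  to i = suc (toℕ i) , s≤s z≤n , toℕ<n i
  from : Range m → Fin m
  from (suc k , _ , k<m) = fromℕ< k<m
  to∘from : ∀ x → to (from x) ≡ x
  to∘from (suc k , s≤s z≤n , k<m) = Range-≡ (cong suc (toℕ-fromℕ< k<m))
  from∘to : ∀ i → from (to i) ≡ i
  from∘to i = fromℕ<-toℕ i (toℕ<n i)

vertexFirstLabeling : (G : Digraph) → Permutation′ (A G) → TotalLabeling G
vertexFirstLabeling G π = ↔⇒⤖ (Fin↔Range ↔-∘ (↔-sym +↔⊎ ↔-∘ (↔-id _ ⊎-↔ π)))

module _ (G : Digraph) (π : Permutation′ (A G)) where

  lab-vertexFirst-vertex : ∀ v → lab G (vertexFirstLabeling G π) (inj₁ v) ≡ suc (toℕ v)
  lab-vertexFirst-vertex v = cong suc (toℕ-↑ˡ v (A G))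

  lab-vertexFirst-arc : ∀ a → lab G (vertexFirstLabeling G π) (inj₂ a) ≡ suc (V G + toℕ (π ⟨$⟩ʳ a))
  lab-vertexFirst-arc a = cong suc (toℕ-↑ʳ (V G) (π ⟨$⟩ʳ a))

  vertexFirstLabeling-isStrong : IsStrong G (vertexFirstLabeling G π)
  vertexFirstLabeling-isStrong v = subst (_≤ V G) (sym (lab-vertexFirst-vertex v)) (toℕ<n v)

wt⁻≡⊖ : (G : Digraph) (lam : TotalLabeling G) (a : Fin (A G)) →
        wt⁻ G lam a ≡ (lab G lam (inj₂ a) + lab G lam (inj₁ (head G a))) ⊖ lab G lam (inj₁ (tail G a))
wt⁻≡⊖ G lam a = trans (cong (_- + ℓ (inj₁ (tail G a))) (sym (pos-+ (ℓ (inj₂ a)) (ℓ (inj₁ (head G a))))))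
                       ([+m]-[+n]≡m⊖n (ℓ (inj₂ a) + ℓ (inj₁ (head G a))) (ℓ (inj₁ (tail G a))))
  where
  ℓ : Elem G → ℕ
  ℓ = lab G lam

[m+n]⊖m≡n : ∀ m n → (m + n) ⊖ m ≡ + n
[m+n]⊖m≡n m n = trans (⊖-≥ (m≤m+n m n)) (cong +_ (m+n∸m≡n m n))

transpose-matchʳ : (i j : Fin m) → PC.transpose i j j ≡ i
transpose-matchʳ i j with j Fin.≟ i
... | yes j≡i = j≡i
... | no _ rewrite dec-true (j Fin.≟ j) refl = refl

transpose-noMatch : {i j k : Fin m} → k ≢ i → k ≢ j → PC.transpose i j k ≡ k
transpose-noMatch {i = i} {j} {k} k≢i k≢j
  rewrite dec-false (k Fin.≟ i) k≢i | dec-false (k Fin.≟ j) k≢j = refl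

-- closesCycle is the arc v_nv_1 and entersCycle the arc u_tv_1.
data ArcKind (n t : ℕ) (a h : Fin (n + t)) : Set where
  forward     : toℕ h ≡ suc (toℕ a) → ArcKind n t a h
  closesCycle : suc (toℕ a) ≡ n → toℕ h ≡ 0 → ArcKind n t a h
  entersCycle : suc (toℕ a) ≡ n + t → toℕ h ≡ 0 → ArcKind n t a h

arcKind : ∀ n t a → ArcKind n t a (tadHead n t a)
arcKind n t a with suc (toℕ a) ℕ.<? n + t
... | no a+1≮n+t = entersCycle (≤-antisym (toℕ<n a) (≮⇒≥ a+1≮n+t)) (toℕ-fromℕ< _)
... | yes a+1<n+t with suc (toℕ a) ℕ.≟ n
...   | yes a+1≡n = closesCycle a+1≡n (toℕ-fromℕ< _)
...   | no _      = forward (toℕ-fromℕ< a+1<n+t)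

module Tadpole (k s : ℕ) where

  n t N : ℕ
  n = 2 + k
  t = 1 + s
  N = n + t

  G : Digraph
  G = tadpole n t

  k+1<N : suc k < N
  k+1<N = s≤s (s≤s (m≤m+n k t))

  k<N : k < N
  k<N = ℕ.<-trans (ℕ.n<1+n k) k+1<N

  -- i and j are the indices of the arcs v_{n-1}v_n and v_nv_1.
  i j : Fin N
  i = fromℕ< k<N
  j = fromℕ< k+1<N

  π : Permutation′ N
  π = transpose i j

  labelling : TotalLabeling G
  labelling = vertexFirstLabeling G π

  π-closesCycle : ∀ {a} → suc (toℕ a) ≡ n → toℕ (π ⟨$⟩ʳ a) ≡ k
  π-closesCycle {a} a+1≡n = begin
    toℕ (π ⟨$⟩ʳ a) ≡⟨ cong (λ x → toℕ (π ⟨$⟩ʳ x)) a≡j ⟩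
    toℕ (π ⟨$⟩ʳ j) ≡⟨ cong toℕ (transpose-matchʳ i j) ⟩
    toℕ i          ≡⟨ toℕ-fromℕ< k<N ⟩
    k              ∎
    where
    a≡j : a ≡ j
    a≡j = toℕ-injective (trans (suc-injective a+1≡n) (sym (toℕ-fromℕ< k+1<N)))

  π-entersCycle : ∀ {a} → suc (toℕ a) ≡ N → π ⟨$⟩ʳ a ≡ a
  π-entersCycle {a} a+1≡N = transpose-noMatch a≢i a≢j
    where
    k+1<a : suc k < toℕ a
    k+1<a = subst (suc k <_) (sym (suc-injective a+1≡N)) (ℕ.m<m+n (suc k) (s≤s z≤n))
    k<a : k < toℕ a
    k<a = ℕ.<-trans (ℕ.n<1+n k) k+1<a
    a≢i : a ≢ i
    a≢i a≡i = <⇒≢ k<a (sym (trans (cong toℕ a≡i) (toℕ-fromℕ< k<N)))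
    a≢j : a ≢ j
    a≢j a≡j = <⇒≢ k+1<a (sym (trans (cong toℕ a≡j) (toℕ-fromℕ< k+1<N)))

  weightExcess : ∀ {a h} → ArcKind n t a h → ℕ
  weightExcess {a} (forward _)   = 2 + toℕ (π ⟨$⟩ʳ a)
  weightExcess (closesCycle _ _) = 0
  weightExcess (entersCycle _ _) = 1

  labelSum : ∀ {a h} (κ : ArcKind n t a h) →
             suc (N + toℕ (π ⟨$⟩ʳ a)) + suc (toℕ h) ≡ suc (toℕ a) + (N + weightExcess κ)
  labelSum {a} (forward h≡a+1) rewrite h≡a+1 = forwardSum N (toℕ (π ⟨$⟩ʳ a)) (toℕ a)
    where
    forwardSum : ∀ M p x → suc (M + p) + suc (suc x) ≡ suc x + (M + (2 + p))
    forwardSum = solve-∀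
  labelSum (closesCycle a+1≡n h≡0) rewrite π-closesCycle a+1≡n | h≡0 | suc-injective a+1≡n = closingSum N k
    where
    closingSum : ∀ M x → suc (M + x) + 1 ≡ suc (suc x) + (M + 0)
    closingSum = solve-∀
  labelSum {a} (entersCycle a+1≡N h≡0) rewrite π-entersCycle a+1≡N | h≡0 = enteringSum N (toℕ a)
    where
    enteringSum : ∀ M x → suc (M + x) + 1 ≡ suc x + (M + 1)
    enteringSum = solve-∀

  wt⁻-labelling : ∀ a → wt⁻ G labelling a ≡ + (N + weightExcess (arcKind n t a))
  wt⁻-labelling a = begin
    wt⁻ G labelling a
      ≡⟨ wt⁻≡⊖ G labelling a ⟩
    (ℓ (inj₂ a) + ℓ (inj₁ (tadHead n t a))) ⊖ ℓ (inj₁ a)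
      ≡⟨ cong₂ _⊖_ (cong₂ _+_ (lab-vertexFirst-arc G π a) (lab-vertexFirst-vertex G π _))
                   (lab-vertexFirst-vertex G π a) ⟩
    (suc (N + toℕ (π ⟨$⟩ʳ a)) + suc (toℕ (tadHead n t a))) ⊖ suc (toℕ a)
      ≡⟨ cong (_⊖ suc (toℕ a)) (labelSum (arcKind n t a)) ⟩
    (suc (toℕ a) + (N + weightExcess (arcKind n t a))) ⊖ suc (toℕ a)
      ≡⟨ [m+n]⊖m≡n (suc (toℕ a)) _ ⟩
    + (N + weightExcess (arcKind n t a)) ∎
    where
    ℓ : Elem G → ℕ
    ℓ = lab G labelling

  weightExcess-injective : ∀ {a b ha hb} (κ : ArcKind n t a ha) (κ′ : ArcKind n t b hb) →
                           weightExcess κ ≡ weightExcess κ′ → a ≡ b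
  weightExcess-injective (forward _) (forward _) e =
    Injection.injective (↔⇒↣ π) (toℕ-injective (suc-injective (suc-injective e)))
  weightExcess-injective (closesCycle a+1≡n _) (closesCycle b+1≡n _) _ =
    toℕ-injective (suc-injective (trans a+1≡n (sym b+1≡n)))
  weightExcess-injective (entersCycle a+1≡N _) (entersCycle b+1≡N _) _ =
    toℕ-injective (suc-injective (trans a+1≡N (sym b+1≡N)))
  weightExcess-injective (forward _) (closesCycle _ _) ()
  weightExcess-injective (forward _) (entersCycle _ _) ()
  weightExcess-injective (closesCycle _ _) (forward _) ()
  weightExcess-injective (closesCycle _ _) (entersCycle _ _) ()
  weightExcess-injective (entersCycle _ _) (forward _) ()
  weightExcess-injective (entersCycle _ _) (closesCycle _ _) ()

  labelling-isSAAL : IsSAAL G labelling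
  labelling-isSAAL {a} {b} wa≡wb =
    weightExcess-injective (arcKind n t a) (arcKind n t b)
      (+-cancelˡ-≡ N _ _ (+-injective (trans (sym (wt⁻-labelling a)) (trans wa≡wb (wt⁻-labelling b)))))

mainTheorem11 : (n t : ℕ) → 3 ≤ n → 1 ≤ t →
    Σ (TotalLabeling (tadpole n t)) λ lam → IsSAAL (tadpole n t) lam × IsStrong (tadpole n t) lam
mainTheorem11 (suc (suc k)) (suc s) _ _ =
  labelling , labelling-isSAAL , vertexFirstLabeling-isStrong G π
  where open Tadpole k s
mainTheorem11 (suc (suc _)) zero _ ()
mainTheorem11 (suc zero)    _    (s≤s ()) _
mainTheorem11 zero          _    ()       _
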